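{- Let $\Delta$ be a pure simplicial complex on vertex set $[n]$ with codimension $c=n-\dim\Delta-1$. If $\overline{e}(\Delta)\le 2c$, then no nonface of $\Delta$ has fewer than $\dim\Delta$ vertices, and at most one (minimal) nonface of $\Delta$ has exactly $\dim\Delta$ vertices.
   Context: A simplicial complex on vertex set $[n]$ contains $\{i\}$ as a face for every $i\in[n]$. $\Delta$ is pure if all facets have the same cardinality; $\dim F=|F|-1$. A nonface is a subset of $[n]$ that is not a face of $\Delta$; a minimal nonface is a nonface minimal under inclusion. An antifacet of $\Delta$ is a subset of $[n]$ of cardinality $\dim\Delta+1$ that is not a face of $\Delta$, and $\overline{e}(\Delta)$ denotes the number of antifacets of $\Delta$. -}

module Defs where

open import Data.Nat using (ℕ; zero; suc; _≟_; _≤_)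
open import Relation.Binary.PropositionalEquality using (_≡_)
open import Data.Bool using (true; false)
open import Data.Fin using (Fin)
open import Data.Fin.Subset using (Subset; _⊆_; ⁅_⁆; ∣_∣; inside; outside)
open import Data.List using (List; []; _∷_; map; _++_; filter; length)
open import Data.Vec using ([]; _∷_)
open import Data.Product using (_×_; ∃-syntax)
open import Relation.Nullary using (¬_; ¬?)
open import Relation.Nullary.Decidable using (_×-dec_)
open import Relation.Unary using (Decidable)

record SimplicialComplex (n : ℕ) : Set₁ where
  field
    IsFace    : Subset n → Set
    isFace?   : Decidable IsFace
    downClosed : ∀ {F G : Subset n} → F ⊆ G → IsFace G → IsFace F
    singletons : ∀ (i : Fin n) → IsFace ⁅ i ⁆

open SimplicialComplex public

module _ {n : ℕ} (Δ : SimplicialComplex n) where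

  IsFacet : Subset n → Set
  IsFacet F = IsFace Δ F × (∀ G → F ⊆ G → IsFace Δ G → G ⊆ F)

  IsNonface : Subset n → Set
  IsNonface F = ¬ IsFace Δ F

  IsMinimalNonface : Subset n → Set
  IsMinimalNonface F = IsNonface F × (∀ G → G ⊆ F → IsNonface G → F ⊆ G)

  -- HasDim d : dim Δ = d, i.e. the largest face has d + 1 vertices.
  -- (dim is a natural number here; the only complex with dim = -1 is the
  --  one on the empty vertex set, for which the theorem is vacuous.)
  HasDim : ℕ → Set
  HasDim d = (∃[ F ] (IsFace Δ F × ∣ F ∣ ≡ suc d)) × (∀ F → IsFace Δ F → ∣ F ∣ ≤ suc d)

  IsPure : Set
  IsPure = ∀ F G → IsFacet F → IsFacet G → ∣ F ∣ ≡ ∣ G ∣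

allSubsets : (n : ℕ) → List (Subset n)
allSubsets zero = [] ∷ []
allSubsets (suc n) = map (outside ∷_) (allSubsets n) ++ map (inside ∷_) (allSubsets n)

antifacetCount : {n : ℕ} → SimplicialComplex n → ℕ → ℕ
antifacetCount {n} Δ d =
  length (filter (λ F → (∣ F ∣ ≟ suc d) ×-dec ¬? (isFace? Δ F)) (allSubsets n))

-- Let d = dim Δ.  Every (d+1)-set covering a nonface of size d is an antifacet.  A d-set F
-- has n - d covers, and two distinct d-sets F, G share at most one cover, namely F ∪ G, so
-- two distinct nonfaces of size d already give 2(n - d) - 1 = 2c + 1 antifacets.  A nonface
-- with fewer than d vertices lies in two distinct d-sets, which are nonfaces as well.
module Submission where

open import Defs
open import Data.Nat using (ℕ; zero; suc; _+_; _*_; _∸_; _≤_; _<_; _≟_; z≤n; s≤s; s≤s⁻¹)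
open import Data.Nat.Properties
open import Data.Fin.Subset using (Subset; ∣_∣; _⊆_; _∪_; inside; outside)
open import Data.Fin.Subset.Properties
  using (_⊆?_; ∣p∣≤n; p⊆q⇒∣p∣≤∣q∣; drop-∷-⊆; out⊆; in⊆in; ⊆-refl; p⊆p∪q; q⊆p∪q; x∈p∪q⁻)
open import Data.Vec using ([]; _∷_; here)
open import Data.Vec.Properties using (∷-injectiveʳ; ≡-dec)
import Data.Bool as B
open import Data.List using (List; []; _∷_; filter; length; map; _++_)
open import Data.List.Properties using (filter-++; length-++; length-filter; filter-some; filter-none)
import Data.List.Relation.Unary.All as All
import Data.List.Relation.Unary.Any as Any
import Data.List.Relation.Binary.Sublist.Propositional as Sublist
open import Data.List.Relation.Binary.Sublist.Propositional.Properties using (filter⁺; length-mono-≤)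
open import Data.Product using (_×_; _,_; proj₁; ∃-syntax)
open import Data.Sum using ([_,_])
open import Function using (_∘_; case_of_)
open import Level using (Level; 0ℓ)
open import Relation.Binary.PropositionalEquality using (_≡_; _≢_; refl; sym; trans; cong; cong₂; subst; module ≡-Reasoning)
open import Relation.Nullary using (¬_; ¬?; Dec; yes; no; contradiction)
open import Relation.Nullary.Decidable using (_×-dec_)
open import Relation.Unary using (Pred; Decidable)
open import Relation.Unary.Properties using (_∪?_; _∩?_)

private variable
  a ℓ : Level
  A : Set a
  n : ℕ

module _ {P Q : Pred A ℓ} (P? : Decidable P) (Q? : Decidable Q) where

  length-filter-∪-∩ : ∀ xs →
    length (filter (P? ∪? Q?) xs) + length (filter (P? ∩? Q?) xs)
      ≡ length (filter P? xs) + length (filter Q? xs)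
  length-filter-∪-∩ [] = refl
  length-filter-∪-∩ (x ∷ xs) with ih ← length-filter-∪-∩ xs | P? x | Q? x
  ... | yes _ | yes _ = cong suc (trans (+-suc _ _) (trans (cong suc ih) (sym (+-suc _ _))))
  ... | yes _ | no _  = cong suc ih
  ... | no _  | yes _ = trans (cong suc ih) (sym (+-suc _ _))
  ... | no _  | no _  = ih

module _ {P : Pred A ℓ} (P? : Decidable P) where

  length-filter-map : ∀ {B : Set a} (f : B → A) xs →
    length (filter P? (map f xs)) ≡ length (filter (P? ∘ f) xs)
  length-filter-map f [] = refl
  length-filter-map f (x ∷ xs) with P? (f x)
  ... | yes _ = cong suc (length-filter-map f xs)
  ... | no _  = length-filter-map f xs

count : {P : Pred (Subset n) ℓ} → Decidable P → ℕ
count {n = n} P? = length (filter P? (allSubsets n))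

module _ {P : Pred (Subset n) ℓ} (P? : Decidable P) where

  count-mono : ∀ {Q : Pred (Subset n) ℓ} (Q? : Decidable Q) → (∀ {H} → P H → Q H) → count P? ≤ count Q?
  count-mono Q? P⇒Q = length-mono-≤ (filter⁺ P? Q? (λ { refl → P⇒Q }) (Sublist.⊆-refl {x = allSubsets n}))

  count-none : (∀ {H} → ¬ P H) → count P? ≡ 0
  count-none ¬P = cong length (filter-none P? (All.universal (λ _ → ¬P) (allSubsets n)))

count-∷ : ∀ {P : Pred (Subset (suc n)) ℓ} (P? : Decidable P) →
  count P? ≡ count (P? ∘ (outside ∷_)) + count (P? ∘ (inside ∷_))
count-∷ {n = n} P? = begin
  length (filter P? (map (outside ∷_) S ++ map (inside ∷_) S))
    ≡⟨ cong length (filter-++ P? (map (outside ∷_) S) (map (inside ∷_) S)) ⟩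
  length (filter P? (map (outside ∷_) S) ++ filter P? (map (inside ∷_) S))
    ≡⟨ length-++ (filter P? (map (outside ∷_) S)) ⟩
  length (filter P? (map (outside ∷_) S)) + length (filter P? (map (inside ∷_) S))
    ≡⟨ cong₂ _+_ (length-filter-map P? (outside ∷_) S) (length-filter-map P? (inside ∷_) S) ⟩
  count (P? ∘ (outside ∷_)) + count (P? ∘ (inside ∷_)) ∎
  where
  open ≡-Reasoning
  S : List (Subset n)
  S = allSubsets n

module _ {P : Pred (Subset (suc n)) ℓ} (P? : Decidable P) where

  count-outside≤ : count (P? ∘ (outside ∷_)) ≤ count P?
  count-outside≤ = ≤-trans (m≤m+n _ _) (≤-reflexive (sym (count-∷ P?)))

  count-inside≤ : count (P? ∘ (inside ∷_)) ≤ count P?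
  count-inside≤ = ≤-trans (m≤n+m _ _) (≤-reflexive (sym (count-∷ P?)))

count-witness : ∀ {P : Pred (Subset n) ℓ} (P? : Decidable P) {H} → P H → 0 < count P?
count-witness {n = zero}  P? {[]}          p = filter-some P? (Any.here p)
count-witness P? {outside ∷ H} p = ≤-trans (count-witness (P? ∘ (outside ∷_)) p) (count-outside≤ P?)
count-witness P? {inside ∷ H}  p = ≤-trans (count-witness (P? ∘ (inside ∷_)) p) (count-inside≤ P?)

count-≤1 : ∀ {P : Pred (Subset n) ℓ} (P? : Decidable P) (S : Subset n) →
  (∀ {H} → P H → H ≡ S) → count P? ≤ 1
count-≤1 P? [] _ = length-filter P? ([] ∷ [])
count-≤1 P? (outside ∷ S) P⇒≡S = ≤-trans (≤-reflexive (count-∷ P?))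
  (+-mono-≤ (count-≤1 (P? ∘ (outside ∷_)) S (∷-injectiveʳ ∘ P⇒≡S))
            (≤-reflexive (count-none (P? ∘ (inside ∷_)) (λ p → case P⇒≡S p of λ ()))))
count-≤1 P? (inside ∷ S) P⇒≡S = ≤-trans (≤-reflexive (count-∷ P?))
  (+-mono-≤ (≤-reflexive (count-none (P? ∘ (outside ∷_)) (λ p → case P⇒≡S p of λ ())))
            (count-≤1 (P? ∘ (inside ∷_)) S (∷-injectiveʳ ∘ P⇒≡S)))

p⊆q⇒∣q∣≤∣p∣⇒p≡q : ∀ {p q : Subset n} → p ⊆ q → ∣ q ∣ ≤ ∣ p ∣ → p ≡ q
p⊆q⇒∣q∣≤∣p∣⇒p≡q {p = []}          {[]}          _   _ = refl
p⊆q⇒∣q∣≤∣p∣⇒p≡q {p = outside ∷ p} {outside ∷ q} p⊆q ∣q∣≤∣p∣ =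
  cong (outside ∷_) (p⊆q⇒∣q∣≤∣p∣⇒p≡q (drop-∷-⊆ p⊆q) ∣q∣≤∣p∣)
p⊆q⇒∣q∣≤∣p∣⇒p≡q {p = inside ∷ p}  {inside ∷ q}  p⊆q ∣q∣≤∣p∣ =
  cong (inside ∷_) (p⊆q⇒∣q∣≤∣p∣⇒p≡q (drop-∷-⊆ p⊆q) (s≤s⁻¹ ∣q∣≤∣p∣))
p⊆q⇒∣q∣≤∣p∣⇒p≡q {p = outside ∷ p} {inside ∷ q}  p⊆q ∣q∣≤∣p∣ =
  contradiction (≤-trans ∣q∣≤∣p∣ (p⊆q⇒∣p∣≤∣q∣ (drop-∷-⊆ p⊆q))) 1+n≰n
p⊆q⇒∣q∣≤∣p∣⇒p≡q {p = inside ∷ p}  {outside ∷ q} p⊆q _ = case p⊆q here of λ ()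

∪-lub : ∀ {p q r : Subset n} → p ⊆ r → q ⊆ r → p ∪ q ⊆ r
∪-lub {p = p} {q} p⊆r q⊆r = [ p⊆r , q⊆r ] ∘ x∈p∪q⁻ p q

p≢q⇒∣p∣<∣p∪q∣ : ∀ {p q : Subset n} → ∣ p ∣ ≤ ∣ q ∣ → p ≢ q → ∣ p ∣ < ∣ p ∪ q ∣
p≢q⇒∣p∣<∣p∪q∣ {p = p} {q} ∣p∣≤∣q∣ p≢q = ≰⇒> λ ∣p∪q∣≤∣p∣ →
  let p≡p∪q = p⊆q⇒∣q∣≤∣p∣⇒p≡q (p⊆p∪q q) ∣p∪q∣≤∣p∣
      q⊆p   = subst (q ⊆_) (sym p≡p∪q) (q⊆p∪q p q)
  in p≢q (sym (p⊆q⇒∣q∣≤∣p∣⇒p≡q q⊆p ∣p∣≤∣q∣))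

infix 4 _⋖_ _⋖?_

_⋖_ : Subset n → Subset n → Set
F ⋖ H = F ⊆ H × ∣ H ∣ ≡ suc ∣ F ∣

_⋖?_ : (F H : Subset n) → Dec (F ⋖ H)
F ⋖? H = F ⊆? H ×-dec ∣ H ∣ ≟ suc ∣ F ∣

⋖-common-cover : ∀ {F G H : Subset n} → ∣ F ∣ ≡ ∣ G ∣ → F ≢ G → F ⋖ H → G ⋖ H → F ∪ G ≡ H
⋖-common-cover ∣F∣≡∣G∣ F≢G (F⊆H , ∣H∣≡1+∣F∣) (G⊆H , _) =
  p⊆q⇒∣q∣≤∣p∣⇒p≡q (∪-lub F⊆H G⊆H)
    (≤-trans (≤-reflexive ∣H∣≡1+∣F∣) (p≢q⇒∣p∣<∣p∪q∣ (≤-reflexive ∣F∣≡∣G∣) F≢G))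

count-covers : ∀ (F : Subset n) → n ∸ ∣ F ∣ ≤ count (F ⋖?_)
count-covers [] = z≤n
count-covers {n = suc m} (outside ∷ F) = begin
  suc m ∸ ∣ F ∣                                  ≤⟨ suc-∸-≤ m ∣ F ∣ ⟩
  suc (m ∸ ∣ F ∣)                                ≡⟨ +-comm 1 (m ∸ ∣ F ∣) ⟩
  (m ∸ ∣ F ∣) + 1                                ≤⟨ +-mono-≤ (≤-trans (count-covers F) covers-outside) cover-inside ⟩
  count (F′⋖? ∘ (outside ∷_)) + count (F′⋖? ∘ (inside ∷_))
                                                 ≡⟨ count-∷ F′⋖? ⟨
  count F′⋖?                                     ∎
  where
  open ≤-Reasoning
  F′⋖? : Decidable (outside ∷ F ⋖_)
  F′⋖? = outside ∷ F ⋖?_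
  covers-outside : count (F ⋖?_) ≤ count (F′⋖? ∘ (outside ∷_))
  covers-outside = count-mono (F ⋖?_) (F′⋖? ∘ (outside ∷_)) (λ (F⊆H , e) → out⊆ F⊆H , e)
  cover-inside : 1 ≤ count (F′⋖? ∘ (inside ∷_))
  cover-inside = count-witness (F′⋖? ∘ (inside ∷_)) (out⊆ ⊆-refl , refl)
  suc-∸-≤ : ∀ m k → suc m ∸ k ≤ suc (m ∸ k)
  suc-∸-≤ m       zero    = ≤-refl
  suc-∸-≤ zero    (suc k) = ≤-trans (m∸n≤m 0 k) z≤n
  suc-∸-≤ (suc m) (suc k) = suc-∸-≤ m k
count-covers (inside ∷ F) = ≤-trans (count-covers F) (≤-trans covers-inside (count-inside≤ F′⋖?))
  where
  F′⋖? : Decidable (inside ∷ F ⋖_)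
  F′⋖? = inside ∷ F ⋖?_
  covers-inside : count (F ⋖?_) ≤ count (F′⋖? ∘ (inside ∷_))
  covers-inside = count-mono (F ⋖?_) (F′⋖? ∘ (inside ∷_)) (λ (F⊆H , e) → in⊆in F⊆H , cong suc e)

count-covers-∪ : ∀ {F G : Subset n} → ∣ F ∣ ≡ ∣ G ∣ → F ≢ G →
  2 * (n ∸ ∣ F ∣) ≤ suc (count ((F ⋖?_) ∪? (G ⋖?_)))
count-covers-∪ {n = n} {F} {G} ∣F∣≡∣G∣ F≢G = begin
  2 * (n ∸ ∣ F ∣)                   ≡⟨ cong ((n ∸ ∣ F ∣) +_) (+-identityʳ (n ∸ ∣ F ∣)) ⟩
  (n ∸ ∣ F ∣) + (n ∸ ∣ F ∣)         ≡⟨ cong ((n ∸ ∣ F ∣) +_) (cong (n ∸_) ∣F∣≡∣G∣) ⟩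
  (n ∸ ∣ F ∣) + (n ∸ ∣ G ∣)         ≤⟨ +-mono-≤ (count-covers F) (count-covers G) ⟩
  count (F ⋖?_) + count (G ⋖?_)     ≡⟨ length-filter-∪-∩ (F ⋖?_) (G ⋖?_) (allSubsets n) ⟨
  count ((F ⋖?_) ∪? (G ⋖?_)) + count ((F ⋖?_) ∩? (G ⋖?_))
                                    ≤⟨ +-monoʳ-≤ _ (count-≤1 ((F ⋖?_) ∩? (G ⋖?_)) (F ∪ G) common-cover) ⟩
  count ((F ⋖?_) ∪? (G ⋖?_)) + 1    ≡⟨ +-comm _ 1 ⟩
  suc (count ((F ⋖?_) ∪? (G ⋖?_))) ∎
  where
  open ≤-Reasoning
  common-cover : ∀ {H} → F ⋖ H × G ⋖ H → H ≡ F ∪ G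
  common-cover (F⋖H , G⋖H) = sym (⋖-common-cover ∣F∣≡∣G∣ F≢G F⋖H G⋖H)

superset-of-size : ∀ (p : Subset n) j → ∣ p ∣ ≤ j → j ≤ n → ∃[ q ] p ⊆ q × ∣ q ∣ ≡ j
superset-of-size [] zero _ _ = [] , (λ ()) , refl
superset-of-size {n = suc m} (outside ∷ p) j ∣p∣≤j j≤1+m with j ≤? m
... | yes j≤m =
  let q , p⊆q , ∣q∣≡j = superset-of-size p j ∣p∣≤j j≤m
  in outside ∷ q , out⊆ p⊆q , ∣q∣≡j
... | no j≰m =
  let q , p⊆q , ∣q∣≡m = superset-of-size p m (∣p∣≤n p) ≤-refl
  in inside ∷ q , out⊆ p⊆q , trans (cong suc ∣q∣≡m) (≤-antisym (≰⇒> j≰m) j≤1+m)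
superset-of-size (inside ∷ p) (suc j) (s≤s ∣p∣≤j) (s≤s j≤m) =
  let q , p⊆q , ∣q∣≡j = superset-of-size p j ∣p∣≤j j≤m
  in inside ∷ q , in⊆in p⊆q , cong suc ∣q∣≡j

two-supersets-of-size : ∀ (p : Subset n) j → ∣ p ∣ < j → j < n →
  ∃[ q ] ∃[ r ] q ≢ r × p ⊆ q × p ⊆ r × ∣ q ∣ ≡ j × ∣ r ∣ ≡ j
two-supersets-of-size (outside ∷ p) (suc j) (s≤s ∣p∣≤j) (s≤s 1+j≤m) =
  let q , p⊆q , ∣q∣≡j   = superset-of-size p j ∣p∣≤j (≤-trans (n≤1+n j) 1+j≤m)
      r , p⊆r , ∣r∣≡1+j = superset-of-size p (suc j) (m≤n⇒m≤1+n ∣p∣≤j) 1+j≤m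
  in inside ∷ q , outside ∷ r , (λ ()) , out⊆ p⊆q , out⊆ p⊆r , cong suc ∣q∣≡j , ∣r∣≡1+j
two-supersets-of-size (inside ∷ p) (suc j) (s≤s ∣p∣<j) (s≤s j<m) =
  let q , r , q≢r , p⊆q , p⊆r , ∣q∣≡j , ∣r∣≡j = two-supersets-of-size p j ∣p∣<j j<m
  in inside ∷ q , inside ∷ r , q≢r ∘ ∷-injectiveʳ , in⊆in p⊆q , in⊆in p⊆r , cong suc ∣q∣≡j , cong suc ∣r∣≡j

module _ (Δ : SimplicialComplex n) (d : ℕ) where

  Antifacet : Pred (Subset n) 0ℓ
  Antifacet H = ∣ H ∣ ≡ suc d × IsNonface Δ H

  antifacet? : Decidable Antifacet
  antifacet? H = (∣ H ∣ ≟ suc d) ×-dec ¬? (isFace? Δ H)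

  nonface⋖⇒antifacet : ∀ {F H} → IsNonface Δ F → ∣ F ∣ ≡ d → F ⋖ H → Antifacet H
  nonface⋖⇒antifacet F∉Δ refl (F⊆H , ∣H∣≡1+∣F∣) = ∣H∣≡1+∣F∣ , F∉Δ ∘ downClosed Δ F⊆H

  distinct-nonfaces⇒many-antifacets : ∀ {F G} → F ≢ G → IsNonface Δ F → IsNonface Δ G →
    ∣ F ∣ ≡ d → ∣ G ∣ ≡ d → 2 * (n ∸ d) ≤ suc (antifacetCount Δ d)
  distinct-nonfaces⇒many-antifacets F≢G F∉Δ G∉Δ refl ∣G∣≡∣F∣ =
    ≤-trans (count-covers-∪ (sym ∣G∣≡∣F∣) F≢G)
      (s≤s (count-mono _ antifacet? [ nonface⋖⇒antifacet F∉Δ refl , nonface⋖⇒antifacet G∉Δ ∣G∣≡∣F∣ ]))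

  few-antifacets⇒nonface-of-size-unique : d < n → antifacetCount Δ d ≤ 2 * (n ∸ suc d) →
    ∀ {F G} → IsNonface Δ F → IsNonface Δ G → ∣ F ∣ ≡ d → ∣ G ∣ ≡ d → F ≡ G
  few-antifacets⇒nonface-of-size-unique d<n few {F} {G} F∉Δ G∉Δ ∣F∣≡d ∣G∣≡d with ≡-dec B._≟_ F G
  ... | yes F≡G = F≡G
  ... | no F≢G = contradiction (begin
    suc (suc (2 * r))          ≡⟨ *-suc 2 r ⟨
    2 * suc r                  ≡⟨ cong (2 *_) (+-∸-assoc 1 d<n) ⟨
    2 * (n ∸ d)                ≤⟨ distinct-nonfaces⇒many-antifacets F≢G F∉Δ G∉Δ ∣F∣≡d ∣G∣≡d ⟩
    suc (antifacetCount Δ d)   ≤⟨ s≤s few ⟩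
    suc (2 * r)                ∎) 1+n≰n
    where
    open ≤-Reasoning
    r : ℕ
    r = n ∸ suc d

lemma3p3 : ∀ {n : ℕ} (Δ : SimplicialComplex n) (d : ℕ) → HasDim Δ d → IsPure Δ →
    antifacetCount Δ d ≤ 2 * (n ∸ suc d) →
    (∀ (F : Subset n) → IsNonface Δ F → ¬ (∣ F ∣ < d))
    × (∀ (F G : Subset n) → IsMinimalNonface Δ F → IsMinimalNonface Δ G →
    ∣ F ∣ ≡ d → ∣ G ∣ ≡ d → F ≡ G)
lemma3p3 {n} Δ d ((F₀ , _ , ∣F₀∣≡1+d) , _) _ few =
  no-small-nonface , λ F G F-min G-min → unique (proj₁ F-min) (proj₁ G-min)
  where
  d<n : d < n
  d<n = ≤-trans (≤-reflexive (sym ∣F₀∣≡1+d)) (∣p∣≤n F₀)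

  unique : ∀ {F G} → IsNonface Δ F → IsNonface Δ G → ∣ F ∣ ≡ d → ∣ G ∣ ≡ d → F ≡ G
  unique = few-antifacets⇒nonface-of-size-unique Δ d d<n few

  no-small-nonface : ∀ F → IsNonface Δ F → ¬ (∣ F ∣ < d)
  no-small-nonface F F∉Δ ∣F∣<d =
    let q , r , q≢r , F⊆q , F⊆r , ∣q∣≡d , ∣r∣≡d = two-supersets-of-size F d ∣F∣<d d<n
    in q≢r (unique (F∉Δ ∘ downClosed Δ F⊆q) (F∉Δ ∘ downClosed Δ F⊆r) ∣q∣≡d ∣r∣≡d)
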